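{- Let $k\ge 2$ and let $\mathbf b=(b_1,\dots,b_{k-1})$ be a sequence of non-negative integers with $\sum_{i=1}^{k-1}b_i=\binom k2$. Then the following are equivalent: (i) $\mathbf b$ is a matching sequence (i.e. $\mathcal B_{\mathbf b}$ has a perfect matching); (ii) the coefficient of the monomial $v_1^{b_1}\cdots v_{k-1}^{b_{k-1}}$ in the polynomial $$\prod_{1\le i<j\le k}\big(v_i+v_{i+1}+\cdots+v_{j-1}\big)$$ is non-zero; (iii) for every $1\le s\le t\le k-1$, $$\sum_{j=s}^{t}b_j\ \ge\ \binom{t-s+2}{2}.$$
   Context: Matching sequence: to $\mathbf b$ associate the bipartite graph $\mathcal B_{\mathbf b}$ with upper class $U=\{(j,l):1\le j\le l\le k-1\}$, lower class $D_{\mathbf b}=\{(i,t):1\le i\le k-1,\ 1\le t\le b_i\}$, and an edge between $(j,l)\in U$ and $(i,t)\in D_{\mathbf b}$ exactly when $j\le i\le l$. The sequence $\mathbf b$ is a matching sequence if $\mathcal B_{\mathbf b}$ has a matching covering all of $D_{\mathbf b}$. The polynomial in (ii) is (up to sign) the Vandermonde product $\prod_{i<j}(\lambda_i-\lambda_j)$ after the substitution $\lambda_i=v_i+\cdots+v_{k-1}$ for $i\le k-1$, $\lambda_k=0$. -}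

module Defs where

open import Data.Nat using (ℕ; zero; suc; _+_; _*_; _∸_; _≡ᵇ_)
open import Data.Nat.Properties using () renaming (_≟_ to _≟ℕ_)
open import Data.Fin using (Fin; toℕ) renaming (_≤_ to _≤F_; _≤?_ to _≤?F_)
open import Data.Vec using (Vec; tabulate; replicate; zipWith)
open import Data.Vec.Properties using (≡-dec)
open import Data.List using (List; []; _∷_; [_]; map; concatMap; foldr; filter; upTo; allFin)
open import Data.Product using (Σ; _×_; _,_; proj₁; proj₂)
open import Data.Nat.ListAction using (sum)
open import Data.Bool using (if_then_else_)
open import Relation.Nullary using (_×-dec_)
open import Relation.Binary.PropositionalEquality using (_≡_)
open import Function.Definitions using (Injective)

-- Conventions: n = k - 1 variables / entries, indexed 0 .. n-1 by Fin n
-- (paper index i corresponds to Fin index i-1).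

-- Bipartite graph B_b.
-- Upper class U = {(j,l) : j ≤ l}, lower class D_b = {(i,t) : t < b_i}.
Upper : ℕ → Set
Upper n = Σ (Fin n × Fin n) (λ jl → proj₁ jl ≤F proj₂ jl)

Lower : (n : ℕ) → (Fin n → ℕ) → Set
Lower n b = Σ (Fin n) (λ i → Fin (b i))

Adjacent : (n : ℕ) (b : Fin n → ℕ) → Upper n → Lower n b → Set
Adjacent n b ((j , l) , _) (i , _) = (j ≤F i) × (i ≤F l)

IsMatchingSequence : (n : ℕ) → (Fin n → ℕ) → Set
IsMatchingSequence n b =
  Σ (Lower n b → Upper n) (λ f →
    Injective _≡_ _≡_ f × ((d : Lower n b) → Adjacent n b (f d) d))

-- Polynomials in n variables v_0 .. v_{n-1} with ℕ coefficients,
-- represented as formal sums of terms (exponent vector , coefficient).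

Poly : ℕ → Set
Poly n = List (Vec ℕ n × ℕ)

oneP : (n : ℕ) → Poly n
oneP n = [ (replicate n 0 , 1) ]

_*P_ : {n : ℕ} → Poly n → Poly n → Poly n
p *P q = concatMap (λ t → map (λ u → (zipWith _+_ (proj₁ t) (proj₁ u) , proj₂ t * proj₂ u)) q) p

var : (n m : ℕ) → Poly n
var n m = [ (tabulate (λ r → if toℕ r ≡ᵇ m then 1 else 0) , 1) ]

linForm : (n i j : ℕ) → Poly n
linForm n i j = concatMap (λ d → var n (i + d)) (upTo (j ∸ i))

pairsUpTo : ℕ → List (ℕ × ℕ)
pairsUpTo n = concatMap (λ j → map (λ i → (i , j)) (upTo j)) (upTo (suc n))

-- ∏_{1 ≤ i < j ≤ k} (v_i + ... + v_{j-1}) with k = n + 1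
-- (0-indexed: ∏_{0 ≤ i < j ≤ n} (v_i + ... + v_{j-1}))
vandermondeLike : (n : ℕ) → Poly n
vandermondeLike n = foldr _*P_ (oneP n) (map (λ ij → linForm n (proj₁ ij) (proj₂ ij)) (pairsUpTo n))

coeff : {n : ℕ} → Poly n → Vec ℕ n → ℕ
coeff p e = sum (map proj₂ (filter (λ t → ≡-dec _≟ℕ_ (proj₁ t) e) p))

sumAll : (n : ℕ) → (Fin n → ℕ) → ℕ
sumAll n b = sum (map b (allFin n))

sumRange : (n : ℕ) → (Fin n → ℕ) → Fin n → Fin n → ℕ
sumRange n b s t = sum (map b (filter (λ j → (s ≤?F j) ×-dec (j ≤?F t)) (allFin n)))

-- Index the variables from 0, so that the factors of the product are the
-- intervals [a, c), 0 ≤ a < c ≤ n = k - 1, the factor for [a, c) being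
-- v_a + ⋯ + v_(c-1). Expanding the product chooses one variable in each factor,
-- i.e. a representative of each interval, and all coefficients are positive, so
-- (ii) says that the intervals have a system of representatives in which every
-- index r occurs exactly b_r times. Matching the t-th vertex above r with the
-- factor holding the t-th occurrence of r turns it into a matching, which gives
-- (i). A matching gives (iii) by counting: the (t-s+2 choose 2) factors inside
-- the window [s, t + 1) and the factors matched to vertices outside [s, t] are
-- all distinct. Conversely, (iii) is Hall's condition for windows, and under it
-- the greedy choice succeeds: the leftmost point p represents the b_p shortest
-- intervals starting at p and the other ones move on to p + 1. The greedy
-- representatives use each index at most b_r times, and since there are as
-- many factors as Σ b_r, exactly b_r times.

module Submission where

open import Defs
open import Data.Nat using (ℕ; zero; suc; _+_; _∸_; _≤_; _<_; _≥_; _⊔_; _⊓_; z≤n; s≤s; s≤s⁻¹)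
open import Data.Nat.Properties
open import Algebra.Properties.CommutativeSemigroup +-commutativeSemigroup using (interchange; x∙yz≈y∙xz)
open import Data.Nat.Combinatorics using (_C_; nC1≡n; nCk+nC[k+1]≡[n+1]C[k+1])
open import Data.Nat.ListAction using (sum)
open import Data.Nat.ListAction.Properties using (sum-++)
open import Data.Bool using (if_then_else_)
open import Data.Fin using (Fin; toℕ; zero; suc; fromℕ<; cast) renaming (_≤_ to _≤F_; _≤?_ to _≤?F_)
open import Data.Fin.Properties
  using (fromℕ<-toℕ; toℕ-injective; toℕ<n; toℕ-fromℕ<; toℕ-cast; cast-involutive)
open import Data.Vec using (Vec; tabulate; replicate; zipWith; lookup)
open import Data.Vec.Properties
  using (≡-dec; lookup-replicate; lookup-zipWith; lookup∘tabulate; tabulate∘lookup; tabulate-cong)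
open import Data.List as List
  using (List; []; _∷_; [_]; _++_; map; length; concatMap; foldr; upTo; filter; take; allFin)
open import Data.List.Properties
  using (map-tabulate; filter-some; filter-accept; filter-reject; length-map; length-++; length-upTo; upTo-∷ʳ;
         length-removeAt′; length-tabulate)
open import Data.List.Relation.Unary.Any as Any using (here; there; _─_)
import Data.List.Relation.Unary.All.Properties as AllP
open import Data.List.Relation.Unary.AllPairs using (AllPairs; []; _∷_)
import Data.List.Relation.Unary.AllPairs.Properties as APP
open import Data.List.Relation.Unary.Unique.Propositional using (Unique)
import Data.List.Relation.Unary.Unique.Propositional.Properties as UP
open import Data.List.Relation.Binary.Disjoint.Propositional using (Disjoint)
open import Data.List.Relation.Binary.Subset.Propositional using (_⊆_)
open import Data.List.Relation.Binary.Pointwise as Pointwise using (Pointwise; []; _∷_; Pointwise-length)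
open import Data.List.Membership.Propositional using (_∈_; find)
open import Data.List.Membership.Propositional.Properties
  using (∈-lookup; ∈-++⁻; ∈-map⁺; ∈-map⁻; ∈-filter⁻; ∈-concatMap⁺; ∈-concatMap⁻; ∈-upTo⁺; ∈-upTo⁻)
open import Data.List.Relation.Unary.All as All using (All; []; _∷_)
open import Data.Product using (∃-syntax; _×_; _,_; proj₁; proj₂; uncurry)
open import Data.Sum using (_⊎_; inj₁; inj₂; [_,_]′)
open import Data.Empty using (⊥-elim)
open import Relation.Nullary using (¬_; ¬?; Dec; does; yes; no)
open import Relation.Unary using (Decidable)
open import Relation.Nullary.Decidable using (dec-true; dec-false; _×-dec_)
open import Relation.Binary.PropositionalEquality hiding ([_])
open import Function using (id; _∘_)
open import Level using (Level)
open import Function.Definitions using (Injective)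
open import Function.Bundles using (_⇔_; mk⇔; Equivalence)

private
  variable
    ℓ ℓ′ : Level
    A : Set ℓ
    B : Set ℓ′

∈-─⁺ : ∀ {x z : A} {ys} (x∈ys : x ∈ ys) → z ∈ ys → z ≢ x → z ∈ (ys ─ x∈ys)
∈-─⁺ (here refl) (here refl) z≢x = ⊥-elim (z≢x refl)
∈-─⁺ (here refl) (there z∈ys) _ = z∈ys
∈-─⁺ (there _) (here refl) _ = here refl
∈-─⁺ (there x∈ys) (there z∈ys) z≢x = there (∈-─⁺ x∈ys z∈ys z≢x)

Unique-⊆⇒length≤ : ∀ {xs ys : List A} → Unique xs → xs ⊆ ys → length xs ≤ length ys
Unique-⊆⇒length≤ [] _ = z≤n
Unique-⊆⇒length≤ {xs = x ∷ xs} {ys} (x∉xs ∷ unique-xs) xs⊆ys = begin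
  suc (length xs)          ≤⟨ s≤s (Unique-⊆⇒length≤ unique-xs xs⊆ys─x) ⟩
  suc (length (ys ─ x∈ys)) ≡⟨ sym (length-removeAt′ ys (Any.index x∈ys)) ⟩
  length ys                ∎
  where
  open ≤-Reasoning
  x∈ys = xs⊆ys (here refl)
  xs⊆ys─x : xs ⊆ (ys ─ x∈ys)
  xs⊆ys─x z∈xs = ∈-─⁺ x∈ys (xs⊆ys (there z∈xs)) (λ z≡x → All.lookup x∉xs z∈xs (sym z≡x))

Unique-concatMap⁺ : ∀ {F : A → List B} (key : B → A) →
                    (∀ x → All (λ y → key y ≡ x) (F x)) → (∀ x → Unique (F x)) →
                    ∀ {xs} → Unique xs → Unique (concatMap F xs)
Unique-concatMap⁺ key keyed uniq [] = []
Unique-concatMap⁺ {F = F} key keyed uniq {x ∷ xs} (x∉xs ∷ unique-xs) =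
  UP.++⁺ (uniq x) (Unique-concatMap⁺ key keyed uniq unique-xs) disjoint
  where
  disjoint : Disjoint (F x) (concatMap F xs)
  disjoint (y∈Fx , y∈rest) with find (∈-concatMap⁻ F {xs = xs} y∈rest)
  ... | x′ , x′∈xs , y∈Fx′ =
    All.lookup x∉xs x′∈xs (trans (sym (All.lookup (keyed x) y∈Fx)) (All.lookup (keyed x′) y∈Fx′))

Unique-lookup-injective : ∀ {xs : List A} → Unique xs → ∀ {i j} → List.lookup xs i ≡ List.lookup xs j → i ≡ j
Unique-lookup-injective (_ ∷ _) {zero} {zero} _ = refl
Unique-lookup-injective (x∉xs ∷ _) {zero} {suc j} eq = ⊥-elim (All.lookup x∉xs (∈-lookup j) eq)
Unique-lookup-injective (x∉xs ∷ _) {suc i} {zero} eq = ⊥-elim (All.lookup x∉xs (∈-lookup i) (sym eq))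
Unique-lookup-injective (_ ∷ unique) {suc i} {suc j} eq = cong suc (Unique-lookup-injective unique eq)

when : Dec A → ℕ → ℕ
when (yes _) v = v
when (no _) v = 0

sum-filter : ∀ {P : A → Set ℓ′} (P? : Decidable P) (f : A → ℕ) xs →
             sum (map f (filter P? xs)) ≡ sum (map (λ x → when (P? x) (f x)) xs)
sum-filter P? f [] = refl
sum-filter P? f (x ∷ xs) with P? x
... | yes _ = cong (f x +_) (sum-filter P? f xs)
... | no _ = sum-filter P? f xs

sum-filter+reject : ∀ {P : A → Set ℓ′} (P? : Decidable P) (f : A → ℕ) xs →
                    sum (map f xs) ≡ sum (map f (filter P? xs)) + sum (map f (filter (¬? ∘ P?) xs))
sum-filter+reject P? f [] = refl
sum-filter+reject P? f (x ∷ xs) with P? x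
... | yes _ = trans (cong (f x +_) (sum-filter+reject P? f xs)) (sym (+-assoc (f x) _ _))
... | no _ = trans (cong (f x +_) (sum-filter+reject P? f xs))
                   (x∙yz≈y∙xz (f x) (sum (map f (filter P? xs))) (sum (map f (filter (¬? ∘ P?) xs))))

δ : ℕ → ℕ → ℕ
δ x y = if does (x ≟ y) then 1 else 0

δ-refl : ∀ x → δ x x ≡ 1
δ-refl x = cong (if_then 1 else 0) (dec-true (x ≟ x) refl)

δ-≢ : ∀ {x y} → x ≢ y → δ x y ≡ 0
δ-≢ {x} {y} x≢y = cong (if_then 1 else 0) (dec-false (x ≟ y) x≢y)

multiplicity : ℕ → List ℕ → ℕ
multiplicity x xs = sum (map (δ x) xs)

multiplicity-here : ∀ {x y} ys → x ≡ y → multiplicity x (y ∷ ys) ≡ suc (multiplicity x ys)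
multiplicity-here {x} ys refl = cong (_+ multiplicity x ys) (δ-refl x)

multiplicity-there : ∀ {x y} ys → x ≢ y → multiplicity x (y ∷ ys) ≡ multiplicity x ys
multiplicity-there {x} ys x≢y = cong (_+ multiplicity x ys) (δ-≢ x≢y)

multiplicity-∉ : ∀ {x} xs → All (x ≢_) xs → multiplicity x xs ≡ 0
multiplicity-∉ [] [] = refl
multiplicity-∉ (y ∷ ys) (x≢y ∷ x∉ys) = trans (multiplicity-there ys x≢y) (multiplicity-∉ ys x∉ys)

-- Occurrences are counted from t = 0.
occurrence : ∀ xs x t → t < multiplicity x xs → Fin (length xs)
occurrence (y ∷ ys) x t t< with x ≟ y | t
... | yes _ | zero = zero
... | yes x≡y | suc t′ = suc (occurrence ys x t′ (s≤s⁻¹ (subst (suc t′ <_) (multiplicity-here ys x≡y) t<)))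
... | no x≢y | t′ = suc (occurrence ys x t′ (subst (t′ <_) (multiplicity-there ys x≢y) t<))

lookup-occurrence : ∀ xs x t t< → List.lookup xs (occurrence xs x t t<) ≡ x
lookup-occurrence (y ∷ ys) x t t< with x ≟ y | t
... | yes x≡y | zero = sym x≡y
... | yes _ | suc t′ = lookup-occurrence ys x t′ _
... | no _ | t′ = lookup-occurrence ys x t′ _

multiplicity-take-occurrence : ∀ xs x t t< → multiplicity x (take (toℕ (occurrence xs x t t<)) xs) ≡ t
multiplicity-take-occurrence (y ∷ ys) x t t< with x ≟ y | t
... | yes _ | zero = refl
... | yes x≡y | suc t′ = trans (multiplicity-here (take (toℕ (occurrence ys x t′ _)) ys) x≡y)
                               (cong suc (multiplicity-take-occurrence ys x t′ _))
... | no x≢y | t′ = trans (multiplicity-there (take (toℕ (occurrence ys x t′ _)) ys) x≢y)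
                          (multiplicity-take-occurrence ys x t′ _)

-- The entry at the position gives back x, the number of x's before it gives back t.
occurrence-injective : ∀ xs {x x′ t t′} t< t′< →
                       occurrence xs x t t< ≡ occurrence xs x′ t′ t′< → x ≡ x′ × t ≡ t′
occurrence-injective xs {x} {x′} {t} {t′} t< t′< eq
  with trans (sym (lookup-occurrence xs x t t<)) (trans (cong (List.lookup xs) eq) (lookup-occurrence xs x′ t′ t′<))
... | refl = refl , (begin
  t                                                       ≡⟨ sym (multiplicity-take-occurrence xs x t t<) ⟩
  multiplicity x (take (toℕ (occurrence xs x t t<)) xs)   ≡⟨ cong (λ k → multiplicity x (take (toℕ k) xs)) eq ⟩
  multiplicity x (take (toℕ (occurrence xs x t′ t′<)) xs) ≡⟨ multiplicity-take-occurrence xs x t′ t′< ⟩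
  t′                                                      ∎)
  where open ≡-Reasoning

-- (a , c) stands for the range [a, c) of variable indices, i.e. for the
-- factor v_a + ⋯ + v_(c-1) = linForm n a c.
Interval : Set
Interval = ℕ × ℕ

_∈ᵢ_ : ℕ → Interval → Set
x ∈ᵢ (a , c) = a ≤ x × x < c

∉ᵢ-empty : ∀ {x a} → ¬ x ∈ᵢ (a , a + 0)
∉ᵢ-empty {x} {a} (a≤x , x<a+0) = <⇒≱ x<a+0 (subst (_≤ x) (sym (+-identityʳ a)) a≤x)

windowSum : (ℕ → ℕ) → ℕ → ℕ → ℕ
windowSum f a zero = 0
windowSum f a (suc d) = f a + windowSum f (suc a) d

∈ᵢ-suc : ∀ {x a d} → x ∈ᵢ (suc a , suc a + d) → x ∈ᵢ (a , a + suc d)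
∈ᵢ-suc {x} {a} {d} (a<x , x<) = <⇒≤ a<x , subst (x <_) (sym (+-suc a d)) x<

windowSum-cong : ∀ {f g} a d → (∀ x → x ∈ᵢ (a , a + d) → f x ≡ g x) → windowSum f a d ≡ windowSum g a d
windowSum-cong a zero f≗g = refl
windowSum-cong a (suc d) f≗g =
  cong₂ _+_ (f≗g a (≤-refl , subst (a <_) (sym (+-suc a d)) (s≤s (m≤m+n a d))))
            (windowSum-cong (suc a) d (λ x x∈ → f≗g x (∈ᵢ-suc x∈)))

windowSum-zero : ∀ {f} a d → (∀ x → x ∈ᵢ (a , a + d) → f x ≡ 0) → windowSum f a d ≡ 0
windowSum-zero a d f≗0 = trans (windowSum-cong a d f≗0) (constZero a d)
  where constZero : ∀ a d → windowSum (λ _ → 0) a d ≡ 0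
        constZero a zero = refl
        constZero a (suc d) = constZero (suc a) d

windowSum-++ : ∀ f a d₁ d₂ → windowSum f a (d₁ + d₂) ≡ windowSum f a d₁ + windowSum f (a + d₁) d₂
windowSum-++ f a zero d₂ = cong (λ a′ → windowSum f a′ d₂) (sym (+-identityʳ a))
windowSum-++ f a (suc d₁) d₂ = begin
  f a + windowSum f (suc a) (d₁ + d₂)                          ≡⟨ cong (f a +_) (windowSum-++ f (suc a) d₁ d₂) ⟩
  f a + (windowSum f (suc a) d₁ + windowSum f (suc a + d₁) d₂) ≡⟨ sym (+-assoc (f a) _ _) ⟩
  f a + windowSum f (suc a) d₁ + windowSum f (suc a + d₁) d₂   ≡⟨ cong (λ a′ → f a + windowSum f (suc a) d₁ + windowSum f a′ d₂)
                                                                      (sym (+-suc a d₁)) ⟩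
  f a + windowSum f (suc a) d₁ + windowSum f (a + suc d₁) d₂   ∎
  where open ≡-Reasoning

windowSum-monoʳ-≤ : ∀ f a {d d′} → d ≤ d′ → windowSum f a d ≤ windowSum f a d′
windowSum-monoʳ-≤ f a {d} {d′} d≤d′ = begin
  windowSum f a d                                ≤⟨ m≤m+n _ _ ⟩
  windowSum f a d + windowSum f (a + d) (d′ ∸ d) ≡⟨ sym (windowSum-++ f a d (d′ ∸ d)) ⟩
  windowSum f a (d + (d′ ∸ d))                   ≡⟨ cong (windowSum f a) (m+[n∸m]≡n d≤d′) ⟩
  windowSum f a d′                               ∎
  where open ≤-Reasoning

windowSum-mono-≤ : ∀ {f g} a d → (∀ x → f x ≤ g x) → windowSum f a d ≤ windowSum g a d
windowSum-mono-≤ a zero f≤g = z≤n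
windowSum-mono-≤ a (suc d) f≤g = +-mono-≤ (f≤g a) (windowSum-mono-≤ (suc a) d f≤g)

windowSum-+ : ∀ f g a d → windowSum (λ x → f x + g x) a d ≡ windowSum f a d + windowSum g a d
windowSum-+ f g a zero = refl
windowSum-+ f g a (suc d) = begin
  f a + g a + windowSum (λ x → f x + g x) (suc a) d           ≡⟨ cong (f a + g a +_) (windowSum-+ f g (suc a) d) ⟩
  f a + g a + (windowSum f (suc a) d + windowSum g (suc a) d) ≡⟨ interchange (f a) (g a) _ _ ⟩
  f a + windowSum f (suc a) d + (g a + windowSum g (suc a) d) ∎
  where open ≡-Reasoning

windowSum-δ : ∀ {y} a d → y ∈ᵢ (a , a + d) → windowSum (λ x → δ x y) a d ≡ 1
windowSum-δ a zero y∈ = ⊥-elim (∉ᵢ-empty y∈)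
windowSum-δ {y} a (suc d) (a≤y , y<) with a ≟ y
... | yes refl = cong₂ _+_ (δ-refl a) (windowSum-zero (suc a) d (λ x (a<x , _) → δ-≢ (>⇒≢ a<x)))
... | no a≢y = cong₂ _+_ (δ-≢ a≢y) (windowSum-δ (suc a) d (≤∧≢⇒< a≤y a≢y , subst (y <_) (+-suc a d) y<))

windowSum-multiplicity : ∀ a d {xs} → All (_∈ᵢ (a , a + d)) xs →
                         windowSum (λ x → multiplicity x xs) a d ≡ length xs
windowSum-multiplicity a d [] = windowSum-zero a d (λ _ _ → refl)
windowSum-multiplicity a d {y ∷ ys} (y∈ ∷ ys∈) = begin
  windowSum (λ x → δ x y + multiplicity x ys) a d                       ≡⟨ windowSum-+ (λ x → δ x y) _ a d ⟩
  windowSum (λ x → δ x y) a d + windowSum (λ x → multiplicity x ys) a d ≡⟨ cong₂ _+_ (windowSum-δ a d y∈)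
                                                                                     (windowSum-multiplicity a d ys∈) ⟩
  suc (length ys)                                                       ∎
  where open ≡-Reasoning

+-mono-≤-≡⇒≡ : ∀ {p q r s} → p ≤ q → r ≤ s → p + r ≡ q + s → p ≡ q × r ≡ s
+-mono-≤-≡⇒≡ {p} {q} {r} {s} p≤q r≤s eq with m≤n⇒m<n∨m≡n p≤q
... | inj₁ p<q = ⊥-elim (<⇒≢ (+-mono-<-≤ p<q r≤s) eq)
... | inj₂ p≡q = p≡q , +-cancelˡ-≡ p r s (trans eq (cong (_+ s) (sym p≡q)))

windowSum-≤-≡⇒≡ : ∀ {f g} a d → (∀ x → f x ≤ g x) → windowSum f a d ≡ windowSum g a d →
                   ∀ x → x ∈ᵢ (a , a + d) → f x ≡ g x
windowSum-≤-≡⇒≡ a zero f≤g _ x x∈ = ⊥-elim (∉ᵢ-empty x∈)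
windowSum-≤-≡⇒≡ a (suc d) f≤g eq x (a≤x , x<)
  with +-mono-≤-≡⇒≡ (f≤g a) (windowSum-mono-≤ (suc a) d f≤g) eq | a ≟ x
... | head≡ , _ | yes refl = head≡
... | _ , tail≡ | no a≢x = windowSum-≤-≡⇒≡ (suc a) d f≤g tail≡ x (≤∧≢⇒< a≤x a≢x , subst (x <_) (+-suc a d) x<)

windowSum-supported : ∀ {f} s e n → s + e ≤ n → (∀ x → x < n → ¬ x ∈ᵢ (s , s + e) → f x ≡ 0) →
                      windowSum f 0 n ≡ windowSum f s e
windowSum-supported {f} s e n s+e≤n vanishes = begin
  windowSum f 0 n                                                 ≡⟨ cong (windowSum f 0) (sym n≡) ⟩
  windowSum f 0 (s + (e + r))                                     ≡⟨ windowSum-++ f 0 s _ ⟩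
  windowSum f 0 s + windowSum f s (e + r)                         ≡⟨ cong (windowSum f 0 s +_) (windowSum-++ f s e r) ⟩
  windowSum f 0 s + (windowSum f s e + windowSum f (s + e) r)     ≡⟨ cong₂ (λ x y → x + (windowSum f s e + y)) before after ⟩
  0 + (windowSum f s e + 0)                                       ≡⟨ +-identityʳ _ ⟩
  windowSum f s e                                                 ∎
  where
  open ≡-Reasoning
  r = n ∸ (s + e)
  n≡ : s + (e + r) ≡ n
  n≡ = trans (sym (+-assoc s e r)) (m+[n∸m]≡n s+e≤n)
  before : windowSum f 0 s ≡ 0
  before = windowSum-zero 0 s λ x (_ , x<s) →
    vanishes x (<-≤-trans x<s (≤-trans (m≤m+n s e) s+e≤n)) (λ (s≤x , _) → <⇒≱ x<s s≤x)
  after : windowSum f (s + e) r ≡ 0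
  after = windowSum-zero (s + e) r λ x (s+e≤x , x<) →
    vanishes x (subst (x <_) (m+[n∸m]≡n s+e≤n) x<) (λ (_ , x<s+e) → <⇒≱ x<s+e s+e≤x)

sum-tabulate-windowSum : ∀ {n} (f : Fin n → ℕ) g a → (∀ j → f j ≡ g (a + toℕ j)) →
                         sum (List.tabulate f) ≡ windowSum g a n
sum-tabulate-windowSum {zero} f g a f≗g = refl
sum-tabulate-windowSum {suc n} f g a f≗g =
  cong₂ _+_ (trans (f≗g zero) (cong g (+-identityʳ a)))
            (sum-tabulate-windowSum (f ∘ suc) g (suc a) λ j → trans (f≗g (suc j)) (cong g (+-suc a (toℕ j))))

Representatives : List Interval → List ℕ → Set
Representatives = Pointwise (λ q x → x ∈ᵢ q)

ExactRepresentatives : ∀ {n} → List Interval → (Fin n → ℕ) → Set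
ExactRepresentatives Q b = ∃[ xs ] Representatives Q xs × (∀ r → multiplicity (toℕ r) xs ≡ b r)

All-representatives : ∀ {P : Interval → Set} {R : ℕ → Set} → (∀ {q x} → P q → x ∈ᵢ q → R x) →
                      ∀ {Q xs} → Representatives Q xs → All P Q → All R xs
All-representatives P⇒R [] [] = []
All-representatives P⇒R (x∈q ∷ reps) (Pq ∷ PQ) = P⇒R Pq x∈q ∷ All-representatives P⇒R reps PQ

unitVec : (n : ℕ) → ℕ → Vec ℕ n
unitVec n x = tabulate (λ r → δ (toℕ r) x)

exponents : (n : ℕ) → List ℕ → Vec ℕ n
exponents n [] = replicate n 0
exponents n (x ∷ xs) = zipWith _+_ (unitVec n x) (exponents n xs)

∏ : (n : ℕ) → List Interval → Poly n
∏ n Q = foldr _*P_ (oneP n) (map (uncurry (linForm n)) Q)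

lookup-exponents : ∀ n xs (r : Fin n) → lookup (exponents n xs) r ≡ multiplicity (toℕ r) xs
lookup-exponents n [] r = lookup-replicate r 0
lookup-exponents n (x ∷ xs) r = begin
  lookup (zipWith _+_ (unitVec n x) (exponents n xs)) r       ≡⟨ lookup-zipWith _+_ r (unitVec n x) (exponents n xs) ⟩
  lookup (unitVec n x) r + lookup (exponents n xs) r          ≡⟨ cong₂ _+_ (lookup∘tabulate _ r) (lookup-exponents n xs r) ⟩
  δ (toℕ r) x + multiplicity (toℕ r) xs                       ∎
  where open ≡-Reasoning

exponents≡tabulate⇔ : ∀ n xs (b : Fin n → ℕ) →
                      exponents n xs ≡ tabulate b ⇔ (∀ r → multiplicity (toℕ r) xs ≡ b r)
exponents≡tabulate⇔ n xs b = mk⇔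
  (λ eq r → trans (sym (lookup-exponents n xs r)) (trans (cong (λ v → lookup v r) eq) (lookup∘tabulate b r)))
  (λ mult≡b → trans (sym (tabulate∘lookup (exponents n xs)))
                    (tabulate-cong λ r → trans (lookup-exponents n xs r) (mult≡b r)))

<-∸⇒+-< : ∀ {a c d} → d < c ∸ a → a + d < c
<-∸⇒+-< {a} {c} {d} d<c∸a = begin-strict
  a + d       <⟨ +-monoʳ-< a d<c∸a ⟩
  a + (c ∸ a) ≡⟨ m+[n∸m]≡n {a} {c} (<⇒≤ (m∸n≢0⇒n<m (λ c∸a≡0 → n≮0 (subst (d <_) c∸a≡0 d<c∸a)))) ⟩
  c           ∎
  where open ≤-Reasoning

∈-linForm⁺ : ∀ n {a c x} → x ∈ᵢ (a , c) → (unitVec n x , 1) ∈ linForm n a c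
∈-linForm⁺ n {a} {c} {x} (a≤x , x<c) =
  ∈-concatMap⁺ (λ d → var n (a + d)) (Any.map unit≡ (∈-upTo⁺ (∸-monoˡ-< x<c a≤x)))
  where unit≡ : ∀ {d} → x ∸ a ≡ d → (unitVec n x , 1) ∈ var n (a + d)
        unit≡ refl = here (cong (λ y → unitVec n y , 1) (sym (m+[n∸m]≡n a≤x)))

∈-linForm⁻ : ∀ n {a c t} → t ∈ linForm n a c → ∃[ x ] x ∈ᵢ (a , c) × t ≡ (unitVec n x , 1)
∈-linForm⁻ n {a} {c} t∈ with find (∈-concatMap⁻ (λ d → var n (a + d)) {xs = upTo (c ∸ a)} t∈)
... | d , d∈ , here refl = a + d , (m≤m+n a d , <-∸⇒+-< {a} {c} (∈-upTo⁻ d∈)) , refl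

∈-∏⁺ : ∀ n {Q xs} → Representatives Q xs → (exponents n xs , 1) ∈ ∏ n Q
∈-∏⁺ n [] = here refl
∈-∏⁺ n {(a , c) ∷ Q} (x∈q ∷ reps) =
  ∈-concatMap⁺ _ {xs = linForm n a c} (Any.map (λ { refl → ∈-map⁺ _ (∈-∏⁺ n reps) }) (∈-linForm⁺ n {a} {c} x∈q))

∈-∏⁻ : ∀ n Q {t} → t ∈ ∏ n Q → ∃[ xs ] Representatives Q xs × t ≡ (exponents n xs , 1)
∈-∏⁻ n [] (here refl) = [] , [] , refl
∈-∏⁻ n ((a , c) ∷ Q) t∈ with find (∈-concatMap⁻ _ {xs = linForm n a c} t∈)
... | u , u∈ , t∈′ with ∈-linForm⁻ n {a} {c} u∈ | ∈-map⁻ _ t∈′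
... | x , x∈q , refl | w , w∈ , refl with ∈-∏⁻ n Q w∈
... | xs , reps , refl = x ∷ xs , x∈q ∷ reps , refl

coeff≢0⇒∈ : ∀ {n} (p : Poly n) e → coeff p e ≢ 0 → ∃[ c ] (e , c) ∈ p
coeff≢0⇒∈ [] e coeff≢0 = ⊥-elim (coeff≢0 refl)
coeff≢0⇒∈ ((e′ , c) ∷ p) e coeff≢0 with ≡-dec _≟_ e′ e
... | yes refl = c , here refl
... | no _ = let c′ , e∈p = coeff≢0⇒∈ p e coeff≢0 in c′ , there e∈p

∈⇒≤coeff : ∀ {n} (p : Poly n) {e c} → (e , c) ∈ p → c ≤ coeff p e
∈⇒≤coeff ((e′ , c′) ∷ p) {e} (here refl) with ≡-dec _≟_ e e
... | yes _ = m≤m+n c′ _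
... | no e≢e = ⊥-elim (e≢e refl)
∈⇒≤coeff ((e′ , c′) ∷ p) {e} (there e∈p) with ≡-dec _≟_ e′ e
... | yes _ = ≤-trans (∈⇒≤coeff p e∈p) (m≤n+m _ c′)
... | no _ = ∈⇒≤coeff p e∈p

coeff-∏≢0⇔ : ∀ n Q (b : Fin n → ℕ) → coeff (∏ n Q) (tabulate b) ≢ 0 ⇔ ExactRepresentatives Q b
coeff-∏≢0⇔ n Q b = mk⇔ ⇒ ⇐
  where
  ⇒ : coeff (∏ n Q) (tabulate b) ≢ 0 → ExactRepresentatives Q b
  ⇒ coeff≢0 with coeff≢0⇒∈ (∏ n Q) (tabulate b) coeff≢0
  ... | c , t∈ with ∈-∏⁻ n Q t∈
  ... | xs , reps , eq = xs , reps , Equivalence.to (exponents≡tabulate⇔ n xs b) (sym (cong proj₁ eq))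
  ⇐ : ExactRepresentatives Q b → coeff (∏ n Q) (tabulate b) ≢ 0
  ⇐ (xs , reps , mult≡b) coeff≡0 = n≮0 (subst (0 <_) coeff≡0 (∈⇒≤coeff (∏ n Q)
      (subst (λ v → (v , 1) ∈ ∏ n Q) (Equivalence.from (exponents≡tabulate⇔ n xs b) mult≡b) (∈-∏⁺ n reps))))

pairsEndingAt : ℕ → List Interval
pairsEndingAt c = map (_, c) (upTo c)

∈-pairsUpTo⁺ : ∀ {n a c} → a < c → c ≤ n → (a , c) ∈ pairsUpTo n
∈-pairsUpTo⁺ {c = c} a<c c≤n =
  ∈-concatMap⁺ pairsEndingAt (Any.map (λ { refl → ∈-map⁺ (_, c) (∈-upTo⁺ a<c) }) (∈-upTo⁺ (s≤s c≤n)))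

∈-pairsUpTo⁻ : ∀ {n q} → q ∈ pairsUpTo n → proj₁ q < proj₂ q × proj₂ q ≤ n
∈-pairsUpTo⁻ {n} q∈ with find (∈-concatMap⁻ pairsEndingAt {xs = upTo (suc n)} q∈)
... | c , c∈ , q∈c with ∈-map⁻ _ q∈c
... | a , a∈ , refl = ∈-upTo⁻ a∈ , s≤s⁻¹ (∈-upTo⁻ c∈)

pairsEndingAt-right : ∀ c → All (λ q → proj₂ q ≡ c) (pairsEndingAt c)
pairsEndingAt-right c = AllP.map⁺ (All.universal (λ _ → refl) (upTo c))

pairsUpTo-unique : ∀ n → Unique (pairsUpTo n)
pairsUpTo-unique n =
  Unique-concatMap⁺ proj₂ pairsEndingAt-right (λ c → UP.map⁺ (cong proj₁) (UP.upTo⁺ c)) (UP.upTo⁺ (suc n))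

sum-upTo : ∀ n → sum (upTo (suc n)) ≡ suc n C 2
sum-upTo zero = refl
sum-upTo (suc n) = begin
  sum (upTo (suc (suc n)))         ≡⟨ cong sum (sym (upTo-∷ʳ (suc n))) ⟩
  sum (upTo (suc n) ++ [ suc n ])  ≡⟨ sum-++ (upTo (suc n)) [ suc n ] ⟩
  sum (upTo (suc n)) + (suc n + 0) ≡⟨ cong₂ _+_ (sum-upTo n) (trans (+-identityʳ (suc n)) (sym (nC1≡n (suc n)))) ⟩
  suc n C 2 + suc n C 1            ≡⟨ +-comm (suc n C 2) _ ⟩
  suc n C 1 + suc n C 2            ≡⟨ nCk+nC[k+1]≡[n+1]C[k+1] (suc n) 1 ⟩
  suc (suc n) C 2                  ∎
  where open ≡-Reasoning

length-pairsUpTo : ∀ n → length (pairsUpTo n) ≡ suc n C 2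
length-pairsUpTo n = trans (length-concatMap (upTo (suc n))) (sum-upTo n)
  where length-concatMap : ∀ cs → length (concatMap pairsEndingAt cs) ≡ sum cs
        length-concatMap [] = refl
        length-concatMap (c ∷ cs) =
          trans (length-++ (pairsEndingAt c))
                (cong₂ _+_ (trans (length-map _ (upTo c)) (length-upTo c)) (length-concatMap cs))

SortedByRight : List Interval → Set
SortedByRight = AllPairs (λ q q′ → proj₂ q ≤ proj₂ q′)

pairsUpTo-sorted : ∀ n → SortedByRight (pairsUpTo n)
pairsUpTo-sorted n = APP.concat⁺ (AllP.map⁺ (All.universal sameRight (upTo (suc n))))
  (APP.map⁺ (APP.applyUpTo⁺₁ id (suc n) (λ c<c′ _ → earlier c<c′)))
  where
  sameRight : ∀ c → SortedByRight (pairsEndingAt c)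
  sameRight c = APP.map⁺ (APP.applyUpTo⁺₂ id c (λ _ _ → ≤-refl))
  earlier : ∀ {c c′} → c < c′ →
            All (λ q → All (λ q′ → proj₂ q ≤ proj₂ q′) (pairsEndingAt c′)) (pairsEndingAt c)
  earlier {c} {c′} c<c′ =
    All.map (λ q≡c → All.map (λ q′≡c′ → subst₂ _≤_ (sym q≡c) (sym q′≡c′) (<⇒≤ c<c′)) (pairsEndingAt-right c′))
            (pairsEndingAt-right c)

Inside : ℕ → ℕ → Interval → Set
Inside s u (a , c) = s ≤ a × c ≤ u

inside? : ∀ s u q → Dec (Inside s u q)
inside? s u (a , c) = (s ≤? a) ×-dec (c ≤? u)

countInside : ℕ → ℕ → List Interval → ℕ
countInside s u Q = length (filter (inside? s u) Q)

countInside-accept : ∀ {s u} q Q → Inside s u q → countInside s u (q ∷ Q) ≡ suc (countInside s u Q)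
countInside-accept {s} {u} q Q inside = cong length (filter-accept (inside? s u) {xs = Q} inside)

countInside-reject : ∀ {s u} q Q → ¬ Inside s u q → countInside s u (q ∷ Q) ≡ countInside s u Q
countInside-reject {s} {u} q Q outside = cong length (filter-reject (inside? s u) {xs = Q} outside)

countInside-∷ : ∀ {s u} q Q → countInside s u Q ≤ countInside s u (q ∷ Q)
countInside-∷ {s} {u} q Q with inside? s u q
... | yes inside = ≤-trans (n≤1+n _) (≤-reflexive (sym (countInside-accept q Q inside)))
... | no outside = ≤-reflexive (sym (countInside-reject q Q outside))

countInside-∷⁺ : ∀ {s u s′ u′} q′ q Q′ Q → (Inside s′ u′ q′ → Inside s u q) →
                 countInside s′ u′ Q′ ≤ countInside s u Q → countInside s′ u′ (q′ ∷ Q′) ≤ countInside s u (q ∷ Q)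
countInside-∷⁺ {s} {u} {s′} {u′} q′ q Q′ Q inside⇒ count≤ with inside? s′ u′ q′
... | yes inside′ = subst₂ _≤_ (sym (countInside-accept q′ Q′ inside′)) (sym (countInside-accept q Q (inside⇒ inside′)))
                           (s≤s count≤)
... | no outside′ = subst (_≤ countInside s u (q ∷ Q)) (sym (countInside-reject q′ Q′ outside′))
                          (≤-trans count≤ (countInside-∷ q Q))

countInside-beyond : ∀ {s u} Q → All (λ q → u < proj₂ q) Q → countInside s u Q ≡ 0
countInside-beyond [] [] = refl
countInside-beyond {s} {u} (q ∷ Q) (u<c ∷ beyond) =
  trans (countInside-reject {s} {u} q Q (λ (_ , c≤u) → <⇒≱ u<c c≤u)) (countInside-beyond Q beyond)

countInside≡0⇒¬Inside : ∀ {s u Q q} → countInside s u Q ≡ 0 → q ∈ Q → ¬ Inside s u q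
countInside≡0⇒¬Inside {s} {u} eq q∈ inside =
  n≮0 (subst (0 <_) eq (filter-some (inside? s u) (Any.map (λ { refl → inside }) q∈)))

shift : ℕ → Interval → Interval
shift s (a , c) = s + a , s + c

shift-pairsUpTo⊆ : ∀ {n s e q} → s + e ≤ n → q ∈ map (shift s) (pairsUpTo e) →
                   q ∈ pairsUpTo n × Inside s (s + e) q
shift-pairsUpTo⊆ {s = s} s+e≤n q∈ with ∈-map⁻ (shift s) q∈
... | (a , c) , q∈e , refl with ∈-pairsUpTo⁻ q∈e
... | a<c , c≤e = ∈-pairsUpTo⁺ (+-monoʳ-< s a<c) (≤-trans (+-monoʳ-≤ s c≤e) s+e≤n) , m≤m+n s a , +-monoʳ-≤ s c≤e

inside-pairsUpTo⇒∈shift : ∀ {n s e q} → q ∈ pairsUpTo n → Inside s (s + e) q →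
                          q ∈ map (shift s) (pairsUpTo (e ⊓ (n ∸ s)))
inside-pairsUpTo⇒∈shift {n} {s} {e} {a , c} q∈ (s≤a , c≤s+e) with ∈-pairsUpTo⁻ q∈
... | a<c , c≤n = subst (_∈ map (shift s) (pairsUpTo (e ⊓ (n ∸ s)))) (cong₂ _,_ (m+[n∸m]≡n s≤a) (m+[n∸m]≡n s≤c))
                        (∈-map⁺ (shift s) (∈-pairsUpTo⁺ (∸-monoˡ-< a<c s≤a) c∸s≤))
  where s≤c = ≤-trans s≤a (<⇒≤ a<c)
        c∸s≤ = ⊓-glb (m≤n+o⇒m∸n≤o c s c≤s+e) (∸-monoˡ-≤ s c≤n)

shift-pairsUpTo-unique : ∀ s e → Unique (map (shift s) (pairsUpTo e))
shift-pairsUpTo-unique s e = UP.map⁺ shift-injective (pairsUpTo-unique e)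
  where shift-injective : ∀ {q q′} → shift s q ≡ shift s q′ → q ≡ q′
        shift-injective eq = cong₂ _,_ (+-cancelˡ-≡ s _ _ (cong proj₁ eq)) (+-cancelˡ-≡ s _ _ (cong proj₂ eq))

-- Only the part of the window up to n contains pairs.
countInside-pairsUpTo : ∀ n s e → countInside s (s + e) (pairsUpTo n) ≤ suc (e ⊓ (n ∸ s)) C 2
countInside-pairsUpTo n s e = begin
  countInside s (s + e) (pairsUpTo n)              ≤⟨ Unique-⊆⇒length≤ (UP.filter⁺ _ (pairsUpTo-unique n)) window⊆ ⟩
  length (map (shift s) (pairsUpTo (e ⊓ (n ∸ s)))) ≡⟨ length-map (shift s) (pairsUpTo (e ⊓ (n ∸ s))) ⟩
  length (pairsUpTo (e ⊓ (n ∸ s)))                 ≡⟨ length-pairsUpTo (e ⊓ (n ∸ s)) ⟩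
  suc (e ⊓ (n ∸ s)) C 2                            ∎
  where
  open ≤-Reasoning
  window⊆ : filter (inside? s (s + e)) (pairsUpTo n) ⊆ map (shift s) (pairsUpTo (e ⊓ (n ∸ s)))
  window⊆ q∈ = let q∈P , inside = ∈-filter⁻ (inside? s (s + e)) {xs = pairsUpTo n} q∈
               in inside-pairsUpTo⇒∈shift q∈P inside

-- (ii) ⇒ (i)

intervalAt : ∀ {Q xs} → Representatives Q xs → Fin (length xs) → Interval
intervalAt {Q} reps k = List.lookup Q (cast (sym (Pointwise-length reps)) k)

lookup-∈ᵢ-intervalAt : ∀ {Q xs} (reps : Representatives Q xs) k → List.lookup xs k ∈ᵢ intervalAt reps k
lookup-∈ᵢ-intervalAt {Q} {xs} reps k = subst (_∈ᵢ intervalAt reps k) (cong (List.lookup xs) cast∘cast≡id)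
  (Pointwise.lookup⁺ reps (cast (sym (Pointwise-length reps)) k))
  where cast∘cast≡id : cast (Pointwise-length reps) (cast (sym (Pointwise-length reps)) k) ≡ k
        cast∘cast≡id = cast-involutive (Pointwise-length reps) (sym (Pointwise-length reps)) k

intervalAt-injective : ∀ {Q xs} (reps : Representatives Q xs) → Unique Q →
                       ∀ {k k′} → intervalAt reps k ≡ intervalAt reps k′ → k ≡ k′
intervalAt-injective reps unique {k} {k′} eq = toℕ-injective (begin
  toℕ k                                           ≡⟨ sym (toℕ-cast _ k) ⟩
  toℕ (cast (sym (Pointwise-length reps)) k)      ≡⟨ cong toℕ (Unique-lookup-injective unique eq) ⟩
  toℕ (cast (sym (Pointwise-length reps)) k′)     ≡⟨ toℕ-cast _ k′ ⟩
  toℕ k′                                          ∎)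
  where open ≡-Reasoning

-- The upper vertex (j , l) of the paper corresponds to the factor v_j + ⋯ + v_l, i.e. to [j, l + 1).
toInterval : ∀ {n} → Upper n → Interval
toInterval ((j , l) , _) = toℕ j , suc (toℕ l)

toInterval-injective : ∀ {n} {u u′ : Upper n} → toInterval u ≡ toInterval u′ → u ≡ u′
toInterval-injective {u = (j , l) , j≤l} {(j′ , l′) , j′≤l′} eq
  with toℕ-injective {i = j} {j = j′} (cong proj₁ eq) | toℕ-injective {i = l} {j = l′} (suc-injective (cong proj₂ eq))
... | refl | refl = cong ((j , l) ,_) (≤-irrelevant j≤l j′≤l′)

toInterval∈pairsUpTo : ∀ {n} (u : Upper n) → toInterval u ∈ pairsUpTo n
toInterval∈pairsUpTo ((j , l) , j≤l) = ∈-pairsUpTo⁺ (s≤s j≤l) (toℕ<n l)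

toUpper : ∀ {n a c} → a < c → c ≤ n → Upper n
toUpper {a = a} {suc c} a<c c<n = (fromℕ< (<-≤-trans a<c c<n) , fromℕ< c<n) ,
  subst₂ _≤_ (sym (toℕ-fromℕ< (<-≤-trans a<c c<n))) (sym (toℕ-fromℕ< c<n)) (s≤s⁻¹ a<c)

toInterval-toUpper : ∀ {n a c} (a<c : a < c) (c≤n : c ≤ n) → toInterval (toUpper a<c c≤n) ≡ (a , c)
toInterval-toUpper {c = suc c} a<c c<n = cong₂ _,_ (toℕ-fromℕ< _) (cong suc (toℕ-fromℕ< _))

toUpper-adjacent : ∀ {n a c} (a<c : a < c) (c≤n : c ≤ n) (b : Fin n → ℕ) {i τ} →
                   toℕ i ∈ᵢ (a , c) → Adjacent n b (toUpper a<c c≤n) (i , τ)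
toUpper-adjacent {c = suc c} a<c c<n b {i} (a≤i , i<c) =
  subst (_≤ toℕ i) (sym (toℕ-fromℕ< _)) a≤i , subst (toℕ i ≤_) (sym (toℕ-fromℕ< _)) (s≤s⁻¹ i<c)

lower-≡ : ∀ {n} {b : Fin n → ℕ} {i i′ : Fin n} {τ : Fin (b i)} {τ′ : Fin (b i′)} →
          toℕ i ≡ toℕ i′ → toℕ τ ≡ toℕ τ′ → _≡_ {A = Lower n b} (i , τ) (i′ , τ′)
lower-≡ {i = i} {i′} i≡i′ τ≡τ′ with toℕ-injective {i = i} {j = i′} i≡i′
... | refl = cong (i ,_) (toℕ-injective τ≡τ′)

representatives⇒matching : ∀ n (b : Fin n → ℕ) → ExactRepresentatives (pairsUpTo n) b → IsMatchingSequence n b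
representatives⇒matching n b (xs , reps , mult≡b) = match , match-injective , match-adjacent
  where
  below-multiplicity : ∀ ((i , τ) : Lower n b) → toℕ τ < multiplicity (toℕ i) xs
  below-multiplicity (i , τ) = subst (toℕ τ <_) (sym (mult≡b i)) (toℕ<n τ)
  position : Lower n b → Fin (length xs)
  position d@(i , τ) = occurrence xs (toℕ i) (toℕ τ) (below-multiplicity d)
  factor : Lower n b → Interval
  factor d = intervalAt reps (position d)
  valid : ∀ d → proj₁ (factor d) < proj₂ (factor d) × proj₂ (factor d) ≤ n
  valid d = ∈-pairsUpTo⁻ (∈-lookup _)
  match : Lower n b → Upper n
  match d = toUpper (proj₁ (valid d)) (proj₂ (valid d))
  toInterval-match : ∀ d → toInterval (match d) ≡ factor d
  toInterval-match d = toInterval-toUpper (proj₁ (valid d)) (proj₂ (valid d))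
  match-injective : Injective _≡_ _≡_ match
  match-injective {d} {d′} eq =
    let same-position = intervalAt-injective reps (pairsUpTo-unique n)
                          (trans (sym (toInterval-match d)) (trans (cong toInterval eq) (toInterval-match d′)))
        i≡i′ , τ≡τ′ = occurrence-injective xs _ _ same-position
    in lower-≡ i≡i′ τ≡τ′
  match-adjacent : ∀ d → Adjacent n b (match d) d
  match-adjacent d@(i , τ) = toUpper-adjacent (proj₁ (valid d)) (proj₂ (valid d)) b {i} {τ}
    (subst (_∈ᵢ factor d) (lookup-occurrence xs (toℕ i) (toℕ τ) (below-multiplicity d))
                          (lookup-∈ᵢ-intervalAt reps (position d)))

-- (i) ⇒ (iii)

verticesAbove : ∀ {n} (b : Fin n → ℕ) → Fin n → List (Lower n b)
verticesAbove b i = map (i ,_) (allFin (b i))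

lowerVertices : ∀ {n} (b : Fin n → ℕ) → List (Fin n) → List (Lower n b)
lowerVertices b = concatMap (verticesAbove b)

lowerVertices-unique : ∀ {n} (b : Fin n → ℕ) {is} → Unique is → Unique (lowerVertices b is)
lowerVertices-unique b = Unique-concatMap⁺ proj₁ (λ i → AllP.map⁺ (All.universal (λ _ → refl) (allFin (b i))))
                                                  (λ i → UP.map⁺ (λ { refl → refl }) (UP.allFin⁺ (b i)))

∈-lowerVertices⁻ : ∀ {n} (b : Fin n → ℕ) {is d} → d ∈ lowerVertices b is → proj₁ d ∈ is
∈-lowerVertices⁻ b {is} d∈ with find (∈-concatMap⁻ (verticesAbove b) {xs = is} d∈)
... | i , i∈is , d∈i with ∈-map⁻ _ d∈i
... | _ , _ , refl = i∈is

length-lowerVertices : ∀ {n} (b : Fin n → ℕ) is → length (lowerVertices b is) ≡ sum (map b is)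
length-lowerVertices b [] = refl
length-lowerVertices b (i ∷ is) = trans (length-++ (verticesAbove b i)) (cong₂ _+_ length-above (length-lowerVertices b is))
  where length-above : length (verticesAbove b i) ≡ b i
        length-above = trans (length-map (_,_ {B = λ i → Fin (b i)} i) (allFin (b i)))
                             (length-tabulate {n = b i} (id {A = Fin (b i)}))

inWindow? : ∀ {n} (s t : Fin n) → Decidable (λ (j : Fin n) → s ≤F j × j ≤F t)
inWindow? s t j = (s ≤?F j) ×-dec (j ≤?F t)

adjacent-outside : ∀ {n b} {u : Upper n} {d : Lower n b} {s t : Fin n} →
                   Adjacent n b u d → ¬ (s ≤F proj₁ d × proj₁ d ≤F t) → ¬ Inside (toℕ s) (suc (toℕ t)) (toInterval u)
adjacent-outside (j≤i , i≤l) i∉[s,t] (s≤j , l<t+1) = i∉[s,t] (≤-trans s≤j j≤i , ≤-trans i≤l (s≤s⁻¹ l<t+1))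

WindowBound : ∀ n → (Fin n → ℕ) → Set
WindowBound n b = (s t : Fin n) → s ≤F t → sumRange n b s t ≥ (toℕ t ∸ toℕ s + 2) C 2

matching⇒windowBound : ∀ n (b : Fin n → ℕ) → sumAll n b ≡ suc n C 2 → IsMatchingSequence n b → WindowBound n b
matching⇒windowBound n b total (match , match-injective , match-adjacent) s t s≤t =
  +-cancelʳ-≤ (sum (map b outside)) _ _ (begin
    (toℕ t ∸ toℕ s + 2) C 2 + sum (map b outside) ≡⟨ cong₂ _+_ (sym length-window) (sym length-images) ⟩
    length window + length images                 ≡⟨ +-comm (length window) _ ⟩
    length images + length window                 ≡⟨ sym (length-++ images) ⟩
    length (images ++ window)                     ≤⟨ Unique-⊆⇒length≤ unique-all all⊆pairs ⟩
    length (pairsUpTo n)                          ≡⟨ length-pairsUpTo n ⟩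
    suc n C 2                                     ≡⟨ sym total ⟩
    sumAll n b                                    ≡⟨ sum-filter+reject (inWindow? s t) b (allFin n) ⟩
    sumRange n b s t + sum (map b outside)        ∎)
  where
  open ≤-Reasoning
  outside : List (Fin n)
  outside = filter (¬? ∘ inWindow? s t) (allFin n)
  images : List Interval
  images = map (toInterval ∘ match) (lowerVertices b outside)
  e : ℕ
  e = suc (toℕ t) ∸ toℕ s
  window : List Interval
  window = map (shift (toℕ s)) (pairsUpTo e)
  s+e≡t+1 : toℕ s + e ≡ suc (toℕ t)
  s+e≡t+1 = m+[n∸m]≡n (≤-trans s≤t (n≤1+n (toℕ t)))
  window⊆ : ∀ {q} → q ∈ window → q ∈ pairsUpTo n × Inside (toℕ s) (suc (toℕ t)) q
  window⊆ {q} q∈ = let q∈P , inside = shift-pairsUpTo⊆ (subst (_≤ n) (sym s+e≡t+1) (toℕ<n t)) q∈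
                   in q∈P , subst (λ u → Inside (toℕ s) u q) s+e≡t+1 inside
  images⊆ : ∀ {q} → q ∈ images → q ∈ pairsUpTo n × ¬ Inside (toℕ s) (suc (toℕ t)) q
  images⊆ q∈ with ∈-map⁻ (toInterval ∘ match) {xs = lowerVertices b outside} q∈
  ... | d , d∈ , refl = toInterval∈pairsUpTo (match d) ,
    adjacent-outside {u = match d} {d} (match-adjacent d)
                     (proj₂ (∈-filter⁻ (¬? ∘ inWindow? s t) {xs = allFin n} (∈-lowerVertices⁻ b d∈)))
  unique-all : Unique (images ++ window)
  unique-all = UP.++⁺ (UP.map⁺ (λ eq → match-injective (toInterval-injective eq))
                                 (lowerVertices-unique b (UP.filter⁺ (¬? ∘ inWindow? s t) (UP.allFin⁺ n))))
                      (shift-pairsUpTo-unique (toℕ s) e)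
                      (λ (q∈images , q∈window) → proj₂ (images⊆ q∈images) (proj₂ (window⊆ q∈window)))
  all⊆pairs : images ++ window ⊆ pairsUpTo n
  all⊆pairs q∈ with ∈-++⁻ images q∈
  ... | inj₁ q∈images = proj₁ (images⊆ q∈images)
  ... | inj₂ q∈window = proj₁ (window⊆ q∈window)
  length-images : length images ≡ sum (map b outside)
  length-images = trans (length-map _ (lowerVertices b outside)) (length-lowerVertices b outside)
  length-window : length window ≡ (toℕ t ∸ toℕ s + 2) C 2
  length-window = begin-equality
    length window             ≡⟨ length-map _ (pairsUpTo e) ⟩
    length (pairsUpTo e)      ≡⟨ length-pairsUpTo e ⟩
    suc e C 2                 ≡⟨ cong (λ m → suc m C 2) (+-∸-assoc 1 s≤t) ⟩
    (2 + (toℕ t ∸ toℕ s)) C 2 ≡⟨ cong (_C 2) (+-comm 2 (toℕ t ∸ toℕ s)) ⟩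
    (toℕ t ∸ toℕ s + 2) C 2   ∎

-- (iii) ⇒ (ii): the greedy choice

≤-⊔-∸-suc : ∀ {L X Y r} → L ≤ X ⊔ (Y ∸ r) → suc L ≤ suc X ⊔ (suc Y ∸ r)
≤-⊔-∸-suc {r = zero} L≤ = s≤s L≤
≤-⊔-∸-suc {X = X} {zero} {suc r} L≤ = ≤-trans (s≤s (subst (_ ≤_) (⊔-identityʳ X) L≤)) (m≤m⊔n (suc X) (0 ∸ r))
≤-⊔-∸-suc {Y = suc Y} {suc r} L≤ = ≤-⊔-∸-suc {Y = Y} {r} L≤

HallFrom : (ℕ → ℕ) → ℕ → List Interval → Set
HallFrom b p Q = ∀ s e → p ≤ s → countInside s (s + e) Q ≤ windowSum b s e

NonEmptyInside : ℕ → ℕ → Interval → Set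
NonEmptyInside s u q = proj₁ q < proj₂ q × Inside s u q

-- One step of the greedy choice at the point p: of the intervals starting at p
-- (listed by increasing right end), the first r receive the representative p and
-- are removed, the others are shortened to start at p + 1.
module Advance (p : ℕ) where

  advance : ℕ → List Interval → List Interval
  advance r [] = []
  advance r ((a , c) ∷ Q) with a ≟ p | r
  ... | yes _ | zero = (suc p , c) ∷ advance zero Q
  ... | yes _ | suc r = advance r Q
  ... | no _ | r = (a , c) ∷ advance r Q

  advance-right : ∀ {P : ℕ → Set} r Q → All (P ∘ proj₂) Q → All (P ∘ proj₂) (advance r Q)
  advance-right r [] [] = []
  advance-right r ((a , c) ∷ Q) (Pc ∷ PQ) with a ≟ p | r
  ... | yes _ | zero = Pc ∷ advance-right zero Q PQ
  ... | yes _ | suc r′ = advance-right r′ Q PQ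
  ... | no _ | r′ = Pc ∷ advance-right r′ Q PQ

  advance-sorted : ∀ r Q → SortedByRight Q → SortedByRight (advance r Q)
  advance-sorted r [] [] = []
  advance-sorted r ((a , c) ∷ Q) (c≤ ∷ sorted) with a ≟ p | r
  ... | yes _ | zero = advance-right zero Q c≤ ∷ advance-sorted zero Q sorted
  ... | yes _ | suc r′ = advance-sorted r′ Q sorted
  ... | no _ | r′ = advance-right r′ Q c≤ ∷ advance-sorted r′ Q sorted

  advance-left : ∀ r Q → All (λ q → p ≤ proj₁ q) Q → All (λ q → suc p ≤ proj₁ q) (advance r Q)
  advance-left r [] [] = []
  advance-left r ((a , c) ∷ Q) (p≤a ∷ p≤Q) with a ≟ p | r
  ... | yes _ | zero = ≤-refl ∷ advance-left zero Q p≤Q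
  ... | yes _ | suc r′ = advance-left r′ Q p≤Q
  ... | no a≢p | r′ = ≤∧≢⇒< p≤a (a≢p ∘ sym) ∷ advance-left r′ Q p≤Q

  advance-nonempty : ∀ r Q → All (λ q → proj₁ q < proj₂ q) Q →
                     All (λ q → proj₁ q < proj₂ q ⊎ proj₂ q ≤ suc p) (advance r Q)
  advance-nonempty r [] [] = []
  advance-nonempty r ((a , c) ∷ Q) (a<c ∷ nonempty) with a ≟ p | r
  ... | yes _ | zero = <-≤-connex (suc p) c ∷ advance-nonempty zero Q nonempty
  ... | yes _ | suc r′ = advance-nonempty r′ Q nonempty
  ... | no _ | r′ = inj₁ a<c ∷ advance-nonempty r′ Q nonempty

  countInside-advance-far : ∀ {s} u r Q → suc p < s → countInside s u (advance r Q) ≤ countInside s u Q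
  countInside-advance-far u r [] _ = z≤n
  countInside-advance-far {s} u r ((a , c) ∷ Q) p+1<s with a ≟ p | r
  ... | yes _ | zero = countInside-∷⁺ (suc p , c) (a , c) (advance zero Q) Q
                         (λ (s≤p+1 , _) → ⊥-elim (<⇒≱ p+1<s s≤p+1)) (countInside-advance-far u zero Q p+1<s)
  ... | yes _ | suc r′ = ≤-trans (countInside-advance-far u r′ Q p+1<s) (countInside-∷ (a , c) Q)
  ... | no _ | r′ = countInside-∷⁺ (a , c) (a , c) (advance r′ Q) Q id (countInside-advance-far u r′ Q p+1<s)

  countInside-advance-zero : ∀ u Q → countInside (suc p) u (advance zero Q) ≤ countInside p u Q
  countInside-advance-zero u [] = z≤n
  countInside-advance-zero u ((a , c) ∷ Q) with a ≟ p
  ... | yes refl = countInside-∷⁺ (suc p , c) (p , c) (advance zero Q) Q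
                     (λ (_ , c≤u) → ≤-refl , c≤u) (countInside-advance-zero u Q)
  ... | no _ = countInside-∷⁺ (a , c) (a , c) (advance zero Q) Q
                 (λ (p+1≤a , c≤u) → <⇒≤ p+1≤a , c≤u) (countInside-advance-zero u Q)

  -- If an interval starting at p and ending by u is shortened rather than removed, then the
  -- r removed ones end by u too, as Q is sorted: this gives the second alternative.
  countInside-advance : ∀ u r Q → All (λ q → p ≤ proj₁ q) Q → SortedByRight Q →
                        countInside (suc p) u (advance r Q) ≤ countInside (suc p) u Q ⊔ (countInside p u Q ∸ r)
  countInside-advance u zero Q _ _ = ≤-trans (countInside-advance-zero u Q) (m≤n⊔m _ _)
  countInside-advance u (suc r) [] _ _ = z≤n
  countInside-advance u (suc r) ((a , c) ∷ Q) (p≤a ∷ p≤Q) (c≤Q ∷ sorted) with a ≟ p | c ≤? u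
  ... | yes refl | yes c≤u = begin
    countInside (suc p) u (advance r Q)
      ≤⟨ countInside-advance u r Q p≤Q sorted ⟩
    countInside (suc p) u Q ⊔ (countInside p u Q ∸ r)
      ≡⟨ cong₂ (λ X Y → X ⊔ (Y ∸ suc r)) (sym (countInside-reject (p , c) Q (<-irrefl refl ∘ proj₁)))
                                         (sym (countInside-accept (p , c) Q (≤-refl , c≤u))) ⟩
    countInside (suc p) u ((p , c) ∷ Q) ⊔ (countInside p u ((p , c) ∷ Q) ∸ suc r) ∎
    where open ≤-Reasoning
  ... | yes refl | no c≰u =
    ≤-trans (≤-reflexive (countInside-beyond (advance r Q) (advance-right r Q (All.map (<-≤-trans (≰⇒> c≰u)) c≤Q)))) z≤n
  ... | no a≢p | yes c≤u = begin
    countInside (suc p) u ((a , c) ∷ advance (suc r) Q)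
      ≡⟨ countInside-accept (a , c) (advance (suc r) Q) inside ⟩
    suc (countInside (suc p) u (advance (suc r) Q))
      ≤⟨ ≤-⊔-∸-suc {r = suc r} (countInside-advance u (suc r) Q p≤Q sorted) ⟩
    suc (countInside (suc p) u Q) ⊔ (suc (countInside p u Q) ∸ suc r)
      ≡⟨ cong₂ (λ X Y → X ⊔ (Y ∸ suc r)) (sym (countInside-accept (a , c) Q inside))
                                         (sym (countInside-accept (a , c) Q (p≤a , c≤u))) ⟩
    countInside (suc p) u ((a , c) ∷ Q) ⊔ (countInside p u ((a , c) ∷ Q) ∸ suc r) ∎
    where open ≤-Reasoning
          inside : Inside (suc p) u (a , c)
          inside = ≤∧≢⇒< p≤a (a≢p ∘ sym) , c≤u
  ... | no a≢p | no c≰u = begin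
    countInside (suc p) u ((a , c) ∷ advance (suc r) Q)
      ≡⟨ countInside-reject (a , c) (advance (suc r) Q) (c≰u ∘ proj₂) ⟩
    countInside (suc p) u (advance (suc r) Q)
      ≤⟨ countInside-advance u (suc r) Q p≤Q sorted ⟩
    countInside (suc p) u Q ⊔ (countInside p u Q ∸ suc r)
      ≡⟨ cong₂ (λ X Y → X ⊔ (Y ∸ suc r)) (sym (countInside-reject (a , c) Q (c≰u ∘ proj₂)))
                                         (sym (countInside-reject (a , c) Q (c≰u ∘ proj₂))) ⟩
    countInside (suc p) u ((a , c) ∷ Q) ⊔ (countInside p u ((a , c) ∷ Q) ∸ suc r) ∎
    where open ≤-Reasoning

  advance-hall : ∀ b Q → All (λ q → p ≤ proj₁ q) Q → SortedByRight Q →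
                 HallFrom b p Q → HallFrom b (suc p) (advance (b p) Q)
  advance-hall b Q p≤Q sorted hall s e p+1≤s with m≤n⇒m<n∨m≡n p+1≤s
  ... | inj₁ p+1<s = ≤-trans (countInside-advance-far (s + e) (b p) Q p+1<s) (hall s e (≤-trans (n≤1+n p) p+1≤s))
  ... | inj₂ refl = begin
    countInside (suc p) (suc p + e) (advance (b p) Q)                        ≤⟨ countInside-advance _ (b p) Q p≤Q sorted ⟩
    countInside (suc p) (suc p + e) Q ⊔ (countInside p (suc p + e) Q ∸ b p) ≤⟨ ⊔-lub (hall (suc p) e (n≤1+n p))
                                                                                      (m≤n+o⇒m∸n≤o _ (b p) hall-at-p) ⟩
    windowSum b (suc p) e                                                    ∎
    where open ≤-Reasoning
          hall-at-p : countInside p (suc p + e) Q ≤ b p + windowSum b (suc p) e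
          hall-at-p = subst (λ u → countInside p u Q ≤ b p + windowSum b (suc p) e) (+-suc p e) (hall p (suc e) ≤-refl)

  advance-representatives⁻ : ∀ r Q → All (λ q → proj₁ q < proj₂ q) Q → ∀ {xs′} → Representatives (advance r Q) xs′ →
         ∃[ xs ] Representatives Q xs × multiplicity p xs ≤ r + multiplicity p xs′
                 × (∀ x → x ≢ p → multiplicity x xs ≡ multiplicity x xs′)
  advance-representatives⁻ r [] [] [] = [] , [] , z≤n , λ _ _ → refl
  advance-representatives⁻ r ((a , c) ∷ Q) (a<c ∷ nonempty) reps′ with a ≟ p | r
  advance-representatives⁻ r ((a , c) ∷ Q) (a<c ∷ nonempty) {y ∷ _} ((p<y , y<c) ∷ reps′) | yes refl | zero =
    let xs , reps , mult-p , mult-x = advance-representatives⁻ zero Q nonempty reps′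
    in y ∷ xs , (<⇒≤ p<y , y<c) ∷ reps , +-monoʳ-≤ (δ p y) mult-p ,
       λ x x≢p → cong (δ x y +_) (mult-x x x≢p)
  advance-representatives⁻ r ((a , c) ∷ Q) (a<c ∷ nonempty) {xs′} reps′ | yes refl | suc r′ =
    let xs , reps , mult-p , mult-x = advance-representatives⁻ r′ Q nonempty reps′
    in p ∷ xs , (≤-refl , a<c) ∷ reps , ≤-trans (≤-reflexive (multiplicity-here {p} xs refl)) (s≤s mult-p) ,
       λ x x≢p → trans (multiplicity-there xs x≢p) (mult-x x x≢p)
  advance-representatives⁻ r ((a , c) ∷ Q) (a<c ∷ nonempty) {y ∷ ys′} (y∈q ∷ reps′) | no _ | r′ =
    let xs , reps , mult-p , mult-x = advance-representatives⁻ r′ Q nonempty reps′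
    in y ∷ xs , y∈q ∷ reps , ≤-trans (+-monoʳ-≤ (δ p y) mult-p) (≤-reflexive (x∙yz≈y∙xz (δ p y) r′ _)) ,
       λ x x≢p → cong (δ x y +_) (mult-x x x≢p)

  advance-within : ∀ b d Q → All (NonEmptyInside p (p + suc d)) Q → HallFrom b (suc p) (advance (b p) Q) →
                   All (NonEmptyInside (suc p) (suc p + d)) (advance (b p) Q)
  advance-within b d Q within hall′ = All.tabulate λ q∈ →
    let p+1≤a = All.lookup (advance-left (b p) Q (All.map (proj₁ ∘ proj₂) within)) q∈
        c≤ = All.lookup (advance-right {P = _≤ suc p + d} (b p) Q
                           (All.map (λ (_ , _ , c≤) → ≤-trans c≤ (≤-reflexive (+-suc p d))) within)) q∈
        -- Hall's condition for the one-point window [p + 1, p + 1] excludes empty intervals.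
        not-empty = countInside≡0⇒¬Inside (n≤0⇒n≡0 (hall′ (suc p) 0 ≤-refl)) q∈
        p+1≤p+1+0 = ≤-reflexive (sym (+-identityʳ (suc p)))
        nonempty = [ id , (λ c≤p+1 → ⊥-elim (not-empty (p+1≤a , ≤-trans c≤p+1 p+1≤p+1+0))) ]′
                     (All.lookup (advance-nonempty (b p) Q (All.map proj₁ within)) q∈)
    in nonempty , p+1≤a , c≤

open Advance

hall⇒representatives : ∀ (b : ℕ → ℕ) d p Q → All (NonEmptyInside p (p + d)) Q → SortedByRight Q → HallFrom b p Q →
                       ∃[ xs ] Representatives Q xs × (∀ x → multiplicity x xs ≤ b x)
hall⇒representatives b zero p [] [] _ _ = [] , [] , λ _ → z≤n
hall⇒representatives b zero p (q ∷ Q) ((a<c , p≤a , c≤p+0) ∷ _) _ _ =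
  ⊥-elim (<-irrefl (sym (+-identityʳ p)) (≤-<-trans p≤a (<-≤-trans a<c c≤p+0)))
hall⇒representatives b (suc d) p Q within sorted hall
  with hall′ ← advance-hall p b Q (All.map (proj₁ ∘ proj₂) within) sorted hall
  with xs′ , reps′ , multiplicity′≤b ← hall⇒representatives b d (suc p) (advance p (b p) Q)
                                          (advance-within p b d Q within hall′) (advance-sorted p (b p) Q sorted) hall′
  with xs , reps , multiplicity-p , multiplicity-x ← advance-representatives⁻ p (b p) Q (All.map proj₁ within) reps′ =
  xs , reps , multiplicity≤b
  where
  multiplicity≤b : ∀ x → multiplicity x xs ≤ b x
  multiplicity≤b x with x ≟ p
  ... | yes refl = begin
    multiplicity p xs        ≤⟨ multiplicity-p ⟩
    b p + multiplicity p xs′ ≡⟨ cong (b p +_) (multiplicity-∉ xs′ p∉xs′) ⟩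
    b p + 0                  ≡⟨ +-identityʳ (b p) ⟩
    b p                      ∎
    where open ≤-Reasoning
          p∉xs′ : All (p ≢_) xs′
          p∉xs′ = All-representatives (λ p<a (a≤y , _) → <⇒≢ (<-≤-trans p<a a≤y))
                                      reps′ (advance-left p (b p) Q (All.map (proj₁ ∘ proj₂) within))
  ... | no x≢p = subst (_≤ b x) (sym (multiplicity-x x x≢p)) (multiplicity′≤b x)

extend : ∀ {n} → (Fin n → ℕ) → ℕ → ℕ
extend {n} b x with x <? n
... | yes x<n = b (fromℕ< x<n)
... | no _ = 0

extend-toℕ : ∀ {n} (b : Fin n → ℕ) r → extend b (toℕ r) ≡ b r
extend-toℕ {n} b r with toℕ r <? n
... | yes r<n = cong b (fromℕ<-toℕ r r<n)
... | no r≮n = ⊥-elim (r≮n (toℕ<n r))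

sumAll-windowSum : ∀ n (b : Fin n → ℕ) → sumAll n b ≡ windowSum (extend b) 0 n
sumAll-windowSum n b =
  trans (cong sum (map-tabulate id b)) (sum-tabulate-windowSum b (extend b) 0 (sym ∘ extend-toℕ b))

sumRange-windowSum : ∀ n (b : Fin n → ℕ) (s t : Fin n) → s ≤F t →
                     sumRange n b s t ≡ windowSum (extend b) (toℕ s) (suc (toℕ t) ∸ toℕ s)
sumRange-windowSum n b s t s≤t = begin
  sumRange n b s t                          ≡⟨ sum-filter (inWindow? s t) b (allFin n) ⟩
  sum (map restricted (allFin n))           ≡⟨ cong sum (map-tabulate id restricted) ⟩
  sum (List.tabulate restricted)            ≡⟨ sum-tabulate-windowSum restricted restrictedℕ 0 restricted≗ ⟩
  windowSum restrictedℕ 0 n                 ≡⟨ windowSum-supported (toℕ s) e n s+e≤n outside-zero ⟩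
  windowSum restrictedℕ (toℕ s) e           ≡⟨ windowSum-cong (toℕ s) e inside-extend ⟩
  windowSum (extend b) (toℕ s) e            ∎
  where
  open ≡-Reasoning
  e = suc (toℕ t) ∸ toℕ s
  s+e≡ : toℕ s + e ≡ suc (toℕ t)
  s+e≡ = m+[n∸m]≡n (≤-trans s≤t (n≤1+n (toℕ t)))
  s+e≤n : toℕ s + e ≤ n
  s+e≤n = subst (_≤ n) (sym s+e≡) (toℕ<n t)
  window? : ∀ x → Dec (toℕ s ≤ x × x ≤ toℕ t)
  window? x = (toℕ s ≤? x) ×-dec (x ≤? toℕ t)
  restricted : Fin n → ℕ
  restricted j = when (inWindow? s t j) (b j)
  restrictedℕ : ℕ → ℕ
  restrictedℕ x = when (window? x) (extend b x)
  restricted≗ : ∀ j → restricted j ≡ restrictedℕ (0 + toℕ j)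
  restricted≗ j with inWindow? s t j
  ... | yes _ = sym (extend-toℕ b j)
  ... | no _ = refl
  outside-zero : ∀ x → x < n → ¬ x ∈ᵢ (toℕ s , toℕ s + e) → restrictedℕ x ≡ 0
  outside-zero x _ x∉ with window? x
  ... | yes (s≤x , x≤t) = ⊥-elim (x∉ (s≤x , subst (x <_) (sym s+e≡) (s≤s x≤t)))
  ... | no _ = refl
  inside-extend : ∀ x → x ∈ᵢ (toℕ s , toℕ s + e) → restrictedℕ x ≡ extend b x
  inside-extend x (s≤x , x<) with window? x
  ... | yes _ = refl
  ... | no x∉ = ⊥-elim (x∉ (s≤x , s≤s⁻¹ (subst (x <_) s+e≡ x<)))

windowBound⇒windowSum : ∀ n (b : Fin n → ℕ) → WindowBound n b →
                        ∀ s k → k ≤ n ∸ s → suc k C 2 ≤ windowSum (extend b) s k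
windowBound⇒windowSum n b bound s zero _ = z≤n
windowBound⇒windowSum n b bound s (suc k) k<n∸s = begin
  suc (suc k) C 2                                       ≡⟨ cong (_C 2) (sym k+2≡) ⟩
  (toℕ tF ∸ toℕ sF + 2) C 2                             ≤⟨ bound sF tF sF≤tF ⟩
  sumRange n b sF tF                                    ≡⟨ sumRange-windowSum n b sF tF sF≤tF ⟩
  windowSum (extend b) (toℕ sF) (suc (toℕ tF) ∸ toℕ sF) ≡⟨ cong₂ (λ s′ t′ → windowSum (extend b) s′ (suc t′ ∸ s′))
                                                                 (toℕ-fromℕ< s<n) (toℕ-fromℕ< s+k<n) ⟩
  windowSum (extend b) s (suc (s + k) ∸ s)              ≡⟨ cong (windowSum (extend b) s)
                                                                (trans (cong (_∸ s) (sym (+-suc s k))) (m+n∸m≡n s (suc k))) ⟩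
  windowSum (extend b) s (suc k)                        ∎
  where
  open ≤-Reasoning
  s<n : s < n
  s<n = m∸n≢0⇒n<m (λ n∸s≡0 → n≮0 (subst (k <_) n∸s≡0 k<n∸s))
  s+k<n : s + k < n
  s+k<n = subst (_≤ n) (trans (+-comm (suc k) s) (+-suc s k)) (m≤o∸n⇒m+n≤o (suc k) (<⇒≤ s<n) k<n∸s)
  sF tF : Fin n
  sF = fromℕ< s<n
  tF = fromℕ< s+k<n
  sF≤tF : sF ≤F tF
  sF≤tF = subst₂ _≤_ (sym (toℕ-fromℕ< s<n)) (sym (toℕ-fromℕ< s+k<n)) (m≤m+n s k)
  k+2≡ : toℕ tF ∸ toℕ sF + 2 ≡ suc (suc k)
  k+2≡ = trans (cong₂ (λ t′ s′ → t′ ∸ s′ + 2) (toℕ-fromℕ< s+k<n) (toℕ-fromℕ< s<n))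
               (trans (cong (_+ 2) (m+n∸m≡n s k)) (+-comm k 2))

windowBound⇒hall : ∀ n (b : Fin n → ℕ) → WindowBound n b → HallFrom (extend b) 0 (pairsUpTo n)
windowBound⇒hall n b bound s e _ = begin
  countInside s (s + e) (pairsUpTo n)    ≤⟨ countInside-pairsUpTo n s e ⟩
  suc (e ⊓ (n ∸ s)) C 2                  ≤⟨ windowBound⇒windowSum n b bound s (e ⊓ (n ∸ s)) (m⊓n≤n e (n ∸ s)) ⟩
  windowSum (extend b) s (e ⊓ (n ∸ s))   ≤⟨ windowSum-monoʳ-≤ (extend b) s (m⊓n≤m e (n ∸ s)) ⟩
  windowSum (extend b) s e               ∎
  where open ≤-Reasoning

pairsUpTo-nonEmptyInside : ∀ n → All (NonEmptyInside 0 (0 + n)) (pairsUpTo n)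
pairsUpTo-nonEmptyInside n = All.tabulate λ q∈ → let a<c , c≤n = ∈-pairsUpTo⁻ q∈ in a<c , z≤n , c≤n

windowBound⇒representatives : ∀ n (b : Fin n → ℕ) → sumAll n b ≡ suc n C 2 → WindowBound n b →
                              ExactRepresentatives (pairsUpTo n) b
windowBound⇒representatives n b total bound
  with xs , reps , multiplicity≤ ← hall⇒representatives (extend b) n 0 (pairsUpTo n) (pairsUpTo-nonEmptyInside n)
                                          (pairsUpTo-sorted n) (windowBound⇒hall n b bound) =
  xs , reps , λ r → trans (windowSum-≤-≡⇒≡ 0 n multiplicity≤ totals≡ (toℕ r) (z≤n , toℕ<n r)) (extend-toℕ b r)
  where
  totals≡ : windowSum (λ x → multiplicity x xs) 0 n ≡ windowSum (extend b) 0 n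
  totals≡ = begin
    windowSum (λ x → multiplicity x xs) 0 n ≡⟨ windowSum-multiplicity 0 n xs∈ ⟩
    length xs                               ≡⟨ sym (Pointwise-length reps) ⟩
    length (pairsUpTo n)                    ≡⟨ length-pairsUpTo n ⟩
    suc n C 2                               ≡⟨ sym total ⟩
    sumAll n b                              ≡⟨ sumAll-windowSum n b ⟩
    windowSum (extend b) 0 n                ∎
    where open ≡-Reasoning
          xs∈ : All (_∈ᵢ (0 , 0 + n)) xs
          xs∈ = All-representatives (λ (_ , _ , c≤n) (_ , x<c) → z≤n , <-≤-trans x<c c≤n) reps (pairsUpTo-nonEmptyInside n)

proposition5p8 : (k : ℕ) → 2 ≤ k → (b : Fin (k ∸ 1) → ℕ) →
    sumAll (k ∸ 1) b ≡ k C 2 →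
    (IsMatchingSequence (k ∸ 1) b ⇔ (coeff (vandermondeLike (k ∸ 1)) (tabulate b) ≢ 0))
    × ((coeff (vandermondeLike (k ∸ 1)) (tabulate b) ≢ 0) ⇔
       ((s t : Fin (k ∸ 1)) → s ≤F t → sumRange (k ∸ 1) b s t ≥ (toℕ t ∸ toℕ s + 2) C 2))
proposition5p8 (suc n) _ b total = mk⇔ (iii⇒ii ∘ i⇒iii) ii⇒i , mk⇔ (i⇒iii ∘ ii⇒i) iii⇒ii
  where
  i⇒iii : IsMatchingSequence n b → WindowBound n b
  i⇒iii = matching⇒windowBound n b total
  iii⇒ii : WindowBound n b → coeff (vandermondeLike n) (tabulate b) ≢ 0
  iii⇒ii = Equivalence.from (coeff-∏≢0⇔ n (pairsUpTo n) b) ∘ windowBound⇒representatives n b total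
  ii⇒i : coeff (vandermondeLike n) (tabulate b) ≢ 0 → IsMatchingSequence n b
  ii⇒i = representatives⇒matching n b ∘ Equivalence.to (coeff-∏≢0⇔ n (pairsUpTo n) b)
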